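{- Let $n=2^k$ with $k\ge0$ and let $(\tau_i^j)_{i,j\in\{1,\dots,n\}}$ be a valid sequence for the Walsh–Hadamard matrix $\mathrm{H}(n)$. For $i\in\{1,\dots,n\}$ define two sequences of length $2n$: $$\beta_i^*=(\tau_i^1,\dots,\tau_i^n;\ \tau_i^1+n,\dots,\tau_i^n+n),$$ $$\gamma_i^*=(\tau_i^1,\ \tau_i^2+n,\ \tau_i^3,\ \tau_i^4+n,\dots,\tau_i^n+n;\ \tau_i^1+n,\ \tau_i^2,\ \tau_i^3+n,\ \tau_i^4,\dots,\tau_i^n),$$ i.e. $\gamma_i^*$ is obtained by adding $n$ to the entries at even positions of a first copy of $\tau_i^*$, followed by a second copy of $\tau_i^*$ with $n$ added to the entries at odd positions. Define, for $i,j\in\{1,\dots,2n\}$, $$\widetilde{\tau}_i^j=\begin{cases}\beta_i^j & \text{if } i\le n,\\ \gamma_{i-n}^j & \text{if } i>n.\end{cases}$$ Then $(\widetilde{\tau}_i^j)$ is a valid sequence for $\mathrm{H}(2n)$.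
   Context: The Walsh–Hadamard matrices are defined by $\mathrm{H}(1)=(1)$ and $\mathrm{H}(2m)=\begin{pmatrix}\mathrm{H}(m) & \mathrm{H}(m)\\ \mathrm{H}(m) & -\mathrm{H}(m)\end{pmatrix}$ for $m$ a power of $2$. Let $M=(M_{ij})$ be an $(N\times N)$-matrix with entries in $\{+1,-1\}$. A valid sequence for $M$ is a family $(\tau_i^j)_{i,j\in\{1,\dots,N\}}$ of integers such that: (1) for each $i\in\{1,\dots,N\}$, $\tau_i^*=(\tau_i^1,\dots,\tau_i^N)$ is a permutation of $\{1,\dots,N\}$ with $\tau_i^1=1$; (2) for all $i_1\neq i_2$ in $\{1,\dots,N\}$ and all $j_1,j_2\in\{1,\dots,N\}$ with $\tau_{i_1}^{j_1}=\tau_{i_2}^{j_2}$ and $\tau_{i_1}^{j_1+1}=\tau_{i_2}^{j_2+1}$, we have $M_{i_1,\tau_{i_1}^{j_1}}\neq M_{i_2,\tau_{i_2}^{j_2}}$ or $M_{i_1,\tau_{i_1}^{j_1+1}}\neq M_{i_2,\tau_{i_2}^{j_2+1}}$. Here the upper indices are taken cyclically: if $j=N$ then $j+1$ means $1$. -}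

module Defs where

open import Data.Nat using (ℕ; zero; suc; _^_; _%_; _≡ᵇ_)
open import Data.Nat.DivMod using (m%n<n)
open import Data.Fin using (Fin; zero; suc; toℕ; fromℕ<; remQuot; combine)
open import Data.Integer using (ℤ; +_; -_)
open import Data.Bool using (Bool; true; false; if_then_else_)
open import Data.Product using (_,_)
open import Data.Sum using (_⊎_)
open import Relation.Binary.PropositionalEquality using (_≡_; _≢_)
open import Function.Definitions using (Bijective)

-- Convention: all indices are 0-based, i.e. index i : Fin N stands for the
-- paper's index i+1 ∈ {1,…,N}, and a value v : Fin N stands for v+1.

-- Walsh–Hadamard matrix H(2^k), defined by the block recursion
-- H(2m) = [[H m, H m], [H m, - H m]].  An index of H(2m) is split via
-- remQuot into (block ∈ Fin 2, index inside the block ∈ Fin m).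
H : (k : ℕ) → Fin (2 ^ k) → Fin (2 ^ k) → ℤ
H zero    i j = + 1
H (suc k) i j with remQuot {2} (2 ^ k) i | remQuot {2} (2 ^ k) j
... | zero     , i′ | zero     , j′ = H k i′ j′
... | zero     , i′ | suc zero , j′ = H k i′ j′
... | suc zero , i′ | zero     , j′ = H k i′ j′
... | suc zero , i′ | suc zero , j′ = - H k i′ j′

next : ∀ {N} → Fin N → Fin N
next {suc N} j = fromℕ< (m%n<n (suc (toℕ j)) (suc N))

record ValidSequence {N : ℕ} (M : Fin N → Fin N → ℤ)
                     (τ : Fin N → Fin N → Fin N) : Set where
  field
    perm  : ∀ i → Bijective _≡_ _≡_ (τ i)
    first : ∀ i (j : Fin N) → toℕ j ≡ 0 → toℕ (τ i j) ≡ 0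
    compat : ∀ i₁ i₂ j₁ j₂ → i₁ ≢ i₂ →
             τ i₁ j₁ ≡ τ i₂ j₂ → τ i₁ (next j₁) ≡ τ i₂ (next j₂) →
             (M i₁ (τ i₁ j₁) ≢ M i₂ (τ i₂ j₂))
               ⊎ (M i₁ (τ i₁ (next j₁)) ≢ M i₂ (τ i₂ (next j₂)))

-- is the 0-based index odd (i.e. the paper's 1-based position even)?
odd : ∀ {N} → Fin N → Bool
odd j = toℕ j % 2 ≡ᵇ 1

-- Indices of size 2n are split
-- as (block ∈ Fin 2, position ∈ Fin n); a value v + n corresponds to
-- block 1, v to block 0 (combine b v has toℕ = b·n + toℕ v).
--   row block 0 (i ≤ n): β_i = (τ_i ; τ_i + n)
--   row block 1 (i > n): γ_{i-n} = first copy with +n at even (1-based)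
--                        positions, second copy with +n at odd positions.
τ̃ : (k : ℕ) → (Fin (2 ^ k) → Fin (2 ^ k) → Fin (2 ^ k))
   → Fin (2 ^ suc k) → Fin (2 ^ suc k) → Fin (2 ^ suc k)
τ̃ k τ I J with remQuot {2} (2 ^ k) I | remQuot {2} (2 ^ k) J
... | zero     , i | zero     , j = combine {2} zero (τ i j)
... | zero     , i | suc zero , j = combine {2} (suc zero) (τ i j)
... | suc zero , i | zero     , j =
      combine {2} (if odd j then suc zero else zero) (τ i j)
... | suc zero , i | suc zero , j =
      combine {2} (if odd j then zero else suc zero) (τ i j)

-- Split each index of size 2n into a half (Fin 2) and an index of size n.  Then
-- τ̃ sends position (c, j) of row (b, i) to the value (c', τ i j), where c' is c
-- flipped iff b = 1 and j is odd, and H(2n) at ((b, i), (d, v)) is H(n) at (i, v)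
-- up to a sign depending only on (b, d).  Hence every row of τ̃ is a permutation,
-- and two rows in the same half inherit compatibility from the rows i₁ ≢ i₂ of τ.
-- Two rows in different halves never share two consecutive values: from j to
-- next j the first half changes its value block iff j wraps around to the first
-- position, which happens simultaneously in both rows since τ maps only the first
-- position to the first value, whereas the second half flips once more because j
-- and next j have opposite parity (n even).
module Submission where

open import Defs
open import Data.Nat using (ℕ; zero; suc; _^_; _+_; _*_; _%_; _<_; _≡ᵇ_)
open import Data.Nat.Properties using (+-suc; *-identityʳ; +-identityʳ; m≤n⇒m<n∨m≡n)
open import Data.Nat.DivMod using (m<n⇒m%n≡m; n%n≡0; m∣n⇒o%n%m≡o%m)
open import Data.Nat.Divisibility using (m∣m*n)
open import Data.Fin using (Fin; zero; suc; toℕ; combine)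
open import Data.Fin.Properties
  using (toℕ-injective; toℕ-fromℕ<; toℕ<n; toℕ-↑ˡ; toℕ-↑ʳ; toℕ-combine;
         remQuot-combine; combine-injective; combine-surjective)
open import Data.Integer using (ℤ; +_; -_)
open import Data.Integer.Properties using (neg-injective)
open import Data.Bool using (Bool; true; false; not)
open import Data.Product using (_,_; _×_; proj₁)
open import Data.Sum using (_⊎_; inj₁; inj₂; map)
open import Data.Empty using (⊥-elim)
open import Relation.Binary.PropositionalEquality
open import Function.Base using (_∘_)
open import Function.Definitions using (Injective; Surjective; Bijective)

flip : Fin 2 → Fin 2
flip zero       = suc zero
flip (suc zero) = zero

flipIf : Bool → Fin 2 → Fin 2
flipIf false c = c
flipIf true  c = flip c

flipIf-involutive : ∀ o c → flipIf o (flipIf o c) ≡ c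
flipIf-involutive false c          = refl
flipIf-involutive true  zero       = refl
flipIf-involutive true  (suc zero) = refl

flipIf-injective : ∀ o {c d} → flipIf o c ≡ flipIf o d → c ≡ d
flipIf-injective o {c} {d} eq = begin
  c                       ≡⟨ flipIf-involutive o c ⟨
  flipIf o (flipIf o c)   ≡⟨ cong (flipIf o) eq ⟩
  flipIf o (flipIf o d)   ≡⟨ flipIf-involutive o d ⟩
  d                       ∎
  where open ≡-Reasoning

flipIf-comm : ∀ o o′ c → flipIf o (flipIf o′ c) ≡ flipIf o′ (flipIf o c)
flipIf-comm false o′    c = refl
flipIf-comm true  false c = refl
flipIf-comm true  true  c = refl

flipIf-not : ∀ o c → flipIf (not o) c ≢ flipIf o c
flipIf-not false zero       ()
flipIf-not false (suc zero) ()
flipIf-not true  zero       ()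
flipIf-not true  (suc zero) ()

isFirst : ∀ {N} → Fin N → Bool
isFirst j = toℕ j ≡ᵇ 0

wraps : ∀ {N} → Fin N → Bool
wraps j = isFirst (next j)

toℕ-next : ∀ {N} (j : Fin (suc N)) → toℕ (next j) ≡ suc (toℕ j) % suc N
toℕ-next j = toℕ-fromℕ< _

next-≡ : ∀ {N} (j j′ : Fin N) → toℕ j′ ≡ suc (toℕ j) → next j ≡ j′
next-≡ {suc N} j j′ eq = toℕ-injective (begin
  toℕ (next j)         ≡⟨ toℕ-next j ⟩
  suc (toℕ j) % suc N  ≡⟨ cong (_% suc N) eq ⟨
  toℕ j′ % suc N       ≡⟨ m<n⇒m%n≡m (toℕ<n j′) ⟩
  toℕ j′               ∎)
  where open ≡-Reasoning

toℕ-next-last : ∀ {N} (j : Fin N) → suc (toℕ j) ≡ N → toℕ (next j) ≡ 0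
toℕ-next-last {suc N} j eq = trans (toℕ-next j) (trans (cong (_% suc N) eq) (n%n≡0 (suc N)))

toℕ-next-< : ∀ {N} (j : Fin N) → suc (toℕ j) < N → toℕ (next j) ≡ suc (toℕ j)
toℕ-next-< {suc N} j j+1<N = trans (toℕ-next j) (m<n⇒m%n≡m j+1<N)

%2≡ᵇ1-suc : ∀ t → (suc t % 2 ≡ᵇ 1) ≡ not (t % 2 ≡ᵇ 1)
%2≡ᵇ1-suc zero          = refl
%2≡ᵇ1-suc (suc zero)    = refl
%2≡ᵇ1-suc (suc (suc t)) = %2≡ᵇ1-suc t

odd-next : ∀ m (j : Fin (2 * m)) → odd (next j) ≡ not (odd j)
odd-next (suc m) j = begin
  toℕ (next j) % 2 ≡ᵇ 1                    ≡⟨ cong (λ t → t % 2 ≡ᵇ 1) (toℕ-next j) ⟩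
  suc (toℕ j) % (2 * suc m) % 2 ≡ᵇ 1       ≡⟨ cong (_≡ᵇ 1)
                                                (m∣n⇒o%n%m≡o%m 2 (2 * suc m) (suc (toℕ j)) (m∣m*n (suc m))) ⟩
  suc (toℕ j) % 2 ≡ᵇ 1                     ≡⟨ %2≡ᵇ1-suc (toℕ j) ⟩
  not (toℕ j % 2 ≡ᵇ 1)                     ∎
  where open ≡-Reasoning

next-combine : ∀ {n} (c : Fin 2) (j : Fin n) → next (combine c j) ≡ combine (flipIf (wraps j) c) (next j)
next-combine {n} c j with m≤n⇒m<n∨m≡n (toℕ<n j)
... | inj₁ j+1<n rewrite cong (_≡ᵇ 0) (toℕ-next-< j j+1<n) = next-≡ _ _ (begin
  toℕ (combine {2} c (next j))  ≡⟨ toℕ-combine c (next j) ⟩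
  n * toℕ c + toℕ (next j)      ≡⟨ cong (_+_ (n * toℕ c)) (toℕ-next-< j j+1<n) ⟩
  n * toℕ c + suc (toℕ j)       ≡⟨ +-suc _ _ ⟩
  suc (n * toℕ c + toℕ j)       ≡⟨ cong suc (toℕ-combine c j) ⟨
  suc (toℕ (combine {2} c j))   ∎)
  where open ≡-Reasoning
... | inj₂ j+1≡n rewrite cong (_≡ᵇ 0) (toℕ-next-last j j+1≡n) = last c
  where
  open ≡-Reasoning
  last : ∀ c → next (combine c j) ≡ combine (flip c) (next j)
  last zero = next-≡ _ _ (begin
    toℕ (combine {2} (suc zero) (next j))  ≡⟨ toℕ-combine {2} (suc zero) (next j) ⟩
    n * 1 + toℕ (next j)                   ≡⟨ cong₂ _+_ (*-identityʳ n) (toℕ-next-last j j+1≡n) ⟩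
    n + 0                                  ≡⟨ +-identityʳ n ⟩
    n                                      ≡⟨ j+1≡n ⟨
    suc (toℕ j)                            ≡⟨ cong suc (toℕ-↑ˡ j _) ⟨
    suc (toℕ (combine {2} zero j))         ∎)
  last (suc zero) = toℕ-injective (begin
    toℕ (next (combine {2} (suc zero) j))  ≡⟨ toℕ-next-last _ (begin
      suc (toℕ (combine {2} (suc zero) j))   ≡⟨ cong suc (toℕ-combine {2} (suc zero) j) ⟩
      suc (n * 1 + toℕ j)                    ≡⟨ +-suc _ _ ⟨
      n * 1 + suc (toℕ j)                    ≡⟨ cong₂ _+_ (*-identityʳ n) j+1≡n ⟩
      n + n                                  ≡⟨ cong (_+_ n) (+-identityʳ n) ⟨
      2 * n                                  ∎) ⟩
    0                                      ≡⟨ toℕ-next-last j j+1≡n ⟨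
    toℕ (next j)                           ≡⟨ toℕ-↑ˡ (next j) _ ⟨
    toℕ (combine {2} zero (next j))        ∎)

toℕ-combine≡0 : ∀ {m n} (c : Fin (suc m)) (j : Fin n) → toℕ (combine c j) ≡ 0 → c ≡ zero × toℕ j ≡ 0
toℕ-combine≡0 {n = n} zero j eq = refl , trans (sym (toℕ-↑ˡ j _)) eq
toℕ-combine≡0 {n = suc n} (suc c) j eq with () ← trans (sym (toℕ-↑ʳ (suc n) (combine c j))) eq

Compatible : ∀ {N} → (Fin N → Fin N → ℤ) → (Fin N → Fin N → Fin N) → (i₁ i₂ j₁ j₂ : Fin N) → Set
Compatible M τ i₁ i₂ j₁ j₂ =
  τ i₁ j₁ ≡ τ i₂ j₂ → τ i₁ (next j₁) ≡ τ i₂ (next j₂) →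
  (M i₁ (τ i₁ j₁) ≢ M i₂ (τ i₂ j₂)) ⊎ (M i₁ (τ i₁ (next j₁)) ≢ M i₂ (τ i₂ (next j₂)))

compatible-sym : ∀ {N} {M : Fin N → Fin N → ℤ} {τ} {i₁ i₂ j₁ j₂} →
  Compatible M τ i₁ i₂ j₁ j₂ → Compatible M τ i₂ i₁ j₂ j₁
compatible-sym compat eq eq′ = map ≢-sym ≢-sym (compat (sym eq) (sym eq′))

blockSign : Fin 2 → Fin 2 → ℤ → ℤ
blockSign zero       d          x = x
blockSign (suc zero) zero       x = x
blockSign (suc zero) (suc zero) x = - x

blockSign-injective : ∀ b d {x y} → blockSign b d x ≡ blockSign b d y → x ≡ y
blockSign-injective zero       d          eq = eq
blockSign-injective (suc zero) zero       eq = eq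
blockSign-injective (suc zero) (suc zero) eq = neg-injective eq

module _ {N} {M : Fin N → Fin N → ℤ} {τ : Fin N → Fin N → Fin N} (V : ValidSequence M τ) where
  open ValidSequence V

  isFirst-τ : ∀ i j → isFirst (τ i j) ≡ isFirst j
  isFirst-τ i zero = cong (_≡ᵇ 0) (first i zero refl)
  isFirst-τ i (suc j) with toℕ (τ i (suc j)) in τij≡0
  ... | suc _ = refl
  ... | zero with () ← proj₁ (perm i) (toℕ-injective (trans τij≡0 (sym (first i zero refl))))

  wraps-cong : ∀ {i₁ i₂ j₁ j₂} → τ i₁ (next j₁) ≡ τ i₂ (next j₂) → wraps j₁ ≡ wraps j₂
  wraps-cong {i₁} {i₂} {j₁} {j₂} eq = begin
    isFirst (next j₁)         ≡⟨ isFirst-τ i₁ (next j₁) ⟨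
    isFirst (τ i₁ (next j₁))  ≡⟨ cong isFirst eq ⟩
    isFirst (τ i₂ (next j₂))  ≡⟨ isFirst-τ i₂ (next j₂) ⟩
    isFirst (next j₂)         ∎
    where open ≡-Reasoning

  compatible-blockSign : ∀ b {i₁ i₂ j₁ j₂ d₁ d₂ d₁′ d₂′} → i₁ ≢ i₂ → d₁ ≡ d₂ → d₁′ ≡ d₂′ →
    τ i₁ j₁ ≡ τ i₂ j₂ → τ i₁ (next j₁) ≡ τ i₂ (next j₂) →
    (blockSign b d₁ (M i₁ (τ i₁ j₁)) ≢ blockSign b d₂ (M i₂ (τ i₂ j₂)))
      ⊎ (blockSign b d₁′ (M i₁ (τ i₁ (next j₁))) ≢ blockSign b d₂′ (M i₂ (τ i₂ (next j₂))))
  compatible-blockSign b {i₁} {i₂} {j₁} {j₂} {d₁} {d₁′ = d₁′} i₁≢i₂ refl refl eq eq′ =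
    map (λ ne → ne ∘ blockSign-injective b d₁) (λ ne → ne ∘ blockSign-injective b d₁′)
        (compat i₁ i₂ j₁ j₂ i₁≢i₂ eq eq′)

twisted-bijective : ∀ {n} {F : Fin (2 * n) → Fin (2 * n)} {f : Fin n → Fin n} (t : Fin n → Bool) →
  Bijective _≡_ _≡_ f → (∀ c j → F (combine c j) ≡ combine (flipIf (t j) c) (f j)) →
  Bijective _≡_ _≡_ F
twisted-bijective {n} {F} {f} t (f-injective , f-surjective) F≡ = injective , surjective
  where
  injective : Injective _≡_ _≡_ F
  injective {x} {y} Fx≡Fy
    with c₁ , j₁ , refl ← combine-surjective {2} {n} x
       | c₂ , j₂ , refl ← combine-surjective {2} {n} y
    with flips≡ , fj≡ ← combine-injective (flipIf (t j₁) c₁) (f j₁) (flipIf (t j₂) c₂) (f j₂)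
                          (trans (sym (F≡ c₁ j₁)) (trans Fx≡Fy (F≡ c₂ j₂)))
    with refl ← f-injective {j₁} {j₂} fj≡
    = cong (λ c → combine c j₁) (flipIf-injective (t j₁) {c₁} {c₂} flips≡)

  surjective : Surjective _≡_ _≡_ F
  surjective y with d , v , refl ← combine-surjective {2} {n} y with j , fj≡v ← f-surjective v =
    combine (flipIf (t j) d) j ,
    λ { refl → trans (F≡ _ j) (cong₂ combine (flipIf-involutive (t j) d) (fj≡v refl)) }

H-combine : ∀ k b i d v → H (suc k) (combine b i) (combine d v) ≡ blockSign b d (H k i v)
H-combine k zero i zero v
  rewrite remQuot-combine {2} {2 ^ k} zero i | remQuot-combine {2} {2 ^ k} zero v = refl
H-combine k zero i (suc zero) v
  rewrite remQuot-combine {2} {2 ^ k} zero i | remQuot-combine {2} {2 ^ k} (suc zero) v = refl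
H-combine k (suc zero) i zero v
  rewrite remQuot-combine {2} {2 ^ k} (suc zero) i | remQuot-combine {2} {2 ^ k} zero v = refl
H-combine k (suc zero) i (suc zero) v
  rewrite remQuot-combine {2} {2 ^ k} (suc zero) i | remQuot-combine {2} {2 ^ k} (suc zero) v = refl

twist : Fin 2 → Bool → Bool
twist zero       o = false
twist (suc zero) o = o

valueBlock : ∀ {n} → Fin 2 → Fin 2 → Fin n → Fin 2
valueBlock b c j = flipIf (twist b (odd j)) c

nextValueBlock : ∀ {n} → Fin 2 → Fin 2 → Fin n → Fin 2
nextValueBlock b c j = valueBlock b (flipIf (wraps j) c) (next j)

valueBlock-first : ∀ {n} b c {j : Fin n} → toℕ j ≡ 0 → valueBlock b c j ≡ c
valueBlock-first zero       c j≡0 = refl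
valueBlock-first (suc zero) c j≡0 = cong (λ t → flipIf (t % 2 ≡ᵇ 1) c) j≡0

τ̃-combine : ∀ k τ b i c j → τ̃ k τ (combine b i) (combine c j) ≡ combine (valueBlock b c j) (τ i j)
τ̃-combine k τ zero i zero j
  rewrite remQuot-combine {2} {2 ^ k} zero i | remQuot-combine {2} {2 ^ k} zero j = refl
τ̃-combine k τ zero i (suc zero) j
  rewrite remQuot-combine {2} {2 ^ k} zero i | remQuot-combine {2} {2 ^ k} (suc zero) j = refl
τ̃-combine k τ (suc zero) i zero j
  rewrite remQuot-combine {2} {2 ^ k} (suc zero) i | remQuot-combine {2} {2 ^ k} zero j
  with odd j
... | false = refl
... | true  = refl
τ̃-combine k τ (suc zero) i (suc zero) j
  rewrite remQuot-combine {2} {2 ^ k} (suc zero) i | remQuot-combine {2} {2 ^ k} (suc zero) j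
  with odd j
... | false = refl
... | true  = refl

τ̃-next-combine : ∀ k τ b i c j →
  τ̃ k τ (combine b i) (next (combine c j)) ≡ combine (nextValueBlock b c j) (τ i (next j))
τ̃-next-combine k τ b i c j =
  trans (cong (τ̃ k τ (combine b i)) (next-combine c j)) (τ̃-combine k τ b i _ (next j))

compatible-combine : ∀ k τ b₁ i₁ b₂ i₂ c₁ j₁ c₂ j₂ →
  (valueBlock b₁ c₁ j₁ ≡ valueBlock b₂ c₂ j₂ → nextValueBlock b₁ c₁ j₁ ≡ nextValueBlock b₂ c₂ j₂ →
   τ i₁ j₁ ≡ τ i₂ j₂ → τ i₁ (next j₁) ≡ τ i₂ (next j₂) →
   (blockSign b₁ (valueBlock b₁ c₁ j₁) (H k i₁ (τ i₁ j₁))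
      ≢ blockSign b₂ (valueBlock b₂ c₂ j₂) (H k i₂ (τ i₂ j₂)))
   ⊎ (blockSign b₁ (nextValueBlock b₁ c₁ j₁) (H k i₁ (τ i₁ (next j₁)))
      ≢ blockSign b₂ (nextValueBlock b₂ c₂ j₂) (H k i₂ (τ i₂ (next j₂))))) →
  Compatible (H (suc k)) (τ̃ k τ) (combine b₁ i₁) (combine b₂ i₂) (combine c₁ j₁) (combine c₂ j₂)
compatible-combine k τ b₁ i₁ b₂ i₂ c₁ j₁ c₂ j₂ split-compatible eq eq′
  with blocks≡ , values≡ ← combine-injective _ _ _ _
         (trans (sym (τ̃-combine k τ b₁ i₁ c₁ j₁)) (trans eq (τ̃-combine k τ b₂ i₂ c₂ j₂)))
     | nextBlocks≡ , nextValues≡ ← combine-injective _ _ _ _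
         (trans (sym (τ̃-next-combine k τ b₁ i₁ c₁ j₁)) (trans eq′ (τ̃-next-combine k τ b₂ i₂ c₂ j₂)))
  = map (λ ne → subst₂ _≢_ (sym (sign b₁ i₁ (τ̃-combine k τ b₁ i₁ c₁ j₁)))
                            (sym (sign b₂ i₂ (τ̃-combine k τ b₂ i₂ c₂ j₂))) ne)
        (λ ne → subst₂ _≢_ (sym (sign b₁ i₁ (τ̃-next-combine k τ b₁ i₁ c₁ j₁)))
                            (sym (sign b₂ i₂ (τ̃-next-combine k τ b₂ i₂ c₂ j₂))) ne)
        (split-compatible blocks≡ nextBlocks≡ values≡ nextValues≡)
  where
  sign : ∀ b i {J d v} → τ̃ k τ (combine b i) J ≡ combine d v →
    H (suc k) (combine b i) (τ̃ k τ (combine b i) J) ≡ blockSign b d (H k i v)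
  sign b i eq = trans (cong (H (suc k) (combine b i)) eq) (H-combine k b i _ _)

-- Needs n even; for n = 1 the two halves are told apart instead by the second
-- row (1, -1) of H(2), see blockSign-flip.
cross-blocks-disagree : ∀ {m} {M : Fin (2 * m) → Fin (2 * m) → ℤ} {τ} → ValidSequence M τ →
  ∀ {i₁ i₂ c₁ j₁ c₂ j₂} → τ i₁ (next j₁) ≡ τ i₂ (next j₂) →
  valueBlock zero c₁ j₁ ≡ valueBlock (suc zero) c₂ j₂ →
  nextValueBlock zero c₁ j₁ ≢ nextValueBlock (suc zero) c₂ j₂
cross-blocks-disagree {m} V {c₁ = c₁} {j₁} {c₂} {j₂} eq c₁≡ nextBlocks≡ =
  flipIf-not (odd j₂) (flipIf (wraps j₂) c₂) (begin
    flipIf (not (odd j₂)) (flipIf (wraps j₂) c₂)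
      ≡⟨ cong (λ o → flipIf o (flipIf (wraps j₂) c₂)) (odd-next m j₂) ⟨
    flipIf (odd (next j₂)) (flipIf (wraps j₂) c₂)  ≡⟨ nextBlocks≡ ⟨
    flipIf (wraps j₁) c₁                           ≡⟨ cong₂ flipIf (wraps-cong V eq) c₁≡ ⟩
    flipIf (wraps j₂) (flipIf (odd j₂) c₂)         ≡⟨ flipIf-comm (wraps j₂) (odd j₂) c₂ ⟩
    flipIf (odd j₂) (flipIf (wraps j₂) c₂)         ∎)
  where open ≡-Reasoning

blockSign-flip : ∀ c → (+ 1 ≢ blockSign (suc zero) c (+ 1)) ⊎ (+ 1 ≢ blockSign (suc zero) (flip c) (+ 1))
blockSign-flip zero       = inj₂ λ ()
blockSign-flip (suc zero) = inj₁ λ ()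

compatible-cross : ∀ k τ → ValidSequence (H k) τ →
  ∀ (i₁ i₂ : Fin (2 ^ k)) (c₁ : Fin 2) (j₁ : Fin (2 ^ k)) (c₂ : Fin 2) (j₂ : Fin (2 ^ k)) →
  Compatible (H (suc k)) (τ̃ k τ)
    (combine {2} zero i₁) (combine {2} (suc zero) i₂) (combine c₁ j₁) (combine c₂ j₂)
compatible-cross zero τ V i₁ i₂ c₁ zero c₂ zero =
  compatible-combine zero τ zero i₁ (suc zero) i₂ c₁ zero c₂ zero (λ _ _ _ _ → blockSign-flip c₂)
compatible-cross (suc k) τ V i₁ i₂ c₁ j₁ c₂ j₂ =
  compatible-combine (suc k) τ zero i₁ (suc zero) i₂ c₁ j₁ c₂ j₂
    (λ blocks≡ nextBlocks≡ _ nextValues≡ →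
       ⊥-elim (cross-blocks-disagree {2 ^ k} V {i₁} {i₂} {c₁} {j₁} {c₂} {j₂}
                 nextValues≡ blocks≡ nextBlocks≡))

module _ (k : ℕ) (τ : Fin (2 ^ k) → Fin (2 ^ k) → Fin (2 ^ k)) (V : ValidSequence (H k) τ) where
  open ValidSequence V

  τ̃-perm : ∀ I → Bijective _≡_ _≡_ (τ̃ k τ I)
  τ̃-perm I with b , i , refl ← combine-surjective {2} {2 ^ k} I =
    twisted-bijective (λ j → twist b (odd j)) (perm i) (τ̃-combine k τ b i)

  τ̃-first : ∀ I J → toℕ J ≡ 0 → toℕ (τ̃ k τ I J) ≡ 0
  τ̃-first I J J≡0
    with b , i , refl ← combine-surjective {2} {2 ^ k} I
       | c , j , refl ← combine-surjective {2} {2 ^ k} J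
    with refl , j≡0 ← toℕ-combine≡0 c j J≡0 = begin
      toℕ (τ̃ k τ (combine b i) (combine {2} zero j)) ≡⟨ cong toℕ (τ̃-combine k τ b i zero j) ⟩
      toℕ (combine {2} (valueBlock b zero j) (τ i j))  ≡⟨ cong (λ d → toℕ (combine {2} d (τ i j)))
                                                              (valueBlock-first b zero j≡0) ⟩
      toℕ (combine {2} zero (τ i j))                   ≡⟨ toℕ-↑ˡ (τ i j) _ ⟩
      toℕ (τ i j)                                      ≡⟨ first i j j≡0 ⟩
      0                                                ∎
    where open ≡-Reasoning

  compatible-split : ∀ (b₁ b₂ c₁ c₂ : Fin 2) (i₁ i₂ j₁ j₂ : Fin (2 ^ k)) →
    combine b₁ i₁ ≢ combine b₂ i₂ →
    Compatible (H (suc k)) (τ̃ k τ) (combine b₁ i₁) (combine b₂ i₂) (combine c₁ j₁) (combine c₂ j₂)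
  compatible-split zero zero c₁ c₂ i₁ i₂ j₁ j₂ ne =
    compatible-combine k τ zero i₁ zero i₂ c₁ j₁ c₂ j₂
      (compatible-blockSign V zero (ne ∘ cong (combine {2} zero)))
  compatible-split (suc zero) (suc zero) c₁ c₂ i₁ i₂ j₁ j₂ ne =
    compatible-combine k τ (suc zero) i₁ (suc zero) i₂ c₁ j₁ c₂ j₂
      (compatible-blockSign V (suc zero) (ne ∘ cong (combine {2} (suc zero))))
  compatible-split zero (suc zero) c₁ c₂ i₁ i₂ j₁ j₂ _ = compatible-cross k τ V i₁ i₂ c₁ j₁ c₂ j₂
  compatible-split (suc zero) zero c₁ c₂ i₁ i₂ j₁ j₂ _ =
    compatible-sym {M = H (suc k)} {τ̃ k τ} (compatible-cross k τ V i₂ i₁ c₂ j₂ c₁ j₁)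

  τ̃-compat : ∀ I₁ I₂ J₁ J₂ → I₁ ≢ I₂ → Compatible (H (suc k)) (τ̃ k τ) I₁ I₂ J₁ J₂
  τ̃-compat I₁ I₂ J₁ J₂
    with b₁ , i₁ , refl ← combine-surjective {2} {2 ^ k} I₁
       | b₂ , i₂ , refl ← combine-surjective {2} {2 ^ k} I₂
       | c₁ , j₁ , refl ← combine-surjective {2} {2 ^ k} J₁
       | c₂ , j₂ , refl ← combine-surjective {2} {2 ^ k} J₂
    = compatible-split b₁ b₂ c₁ c₂ i₁ i₂ j₁ j₂

proposition2 : (k : ℕ) (τ : Fin (2 ^ k) → Fin (2 ^ k) → Fin (2 ^ k)) →
    ValidSequence (H k) τ → ValidSequence (H (suc k)) (τ̃ k τ)
proposition2 k τ V = record
  { perm   = τ̃-perm k τ V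
  ; first  = τ̃-first k τ V
  ; compat = τ̃-compat k τ V
  }
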